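{- Let $u\in\Sigma_3^\omega$ be cube-free and rich, and suppose $u$ contains none of the factors in the set $F=\{1221,\,00,\,10101,\,212,\,11\}$. Then $u$ has a suffix of the form $h(W)$ for some $W\in\Sigma_3^\omega$.
   Context: $\Sigma_3=\{0,1,2\}$. The morphism $h:\Sigma_3^*\to\Sigma_3^*$ is defined by $h(0)=01$, $h(1)=02$, $h(2)=022$ (extended to infinite words letterwise). A finite word of length $n$ is rich if it has $n$ distinct nonempty palindromic factors; an infinite word is rich if all of its finite factors are rich. Cube-free means containing no nonempty factor of the form $xxx$, or more generally no nonempty factor with an exponent $\ge 3$ (exponent $|x|/p$ for a period $p$ of $x$). -}

module Defs where

open import Data.Nat using (ℕ; zero; suc; _+_; _∸_)
open import Data.List using (List; []; _∷_; _++_; length; take; drop; reverse; concatMap; concat; map; upTo; filter; deduplicate)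
import Data.List.Properties as LP
open import Data.Product using (∃; _×_)
open import Relation.Nullary using (¬_; yes; no; Dec)
open import Relation.Binary.PropositionalEquality using (_≡_; _≢_; refl)
open import Relation.Binary.Definitions using (DecidableEquality)

data Σ₃ : Set where
  𝟘 𝟙 𝟚 : Σ₃

_≟Σ_ : DecidableEquality Σ₃
𝟘 ≟Σ 𝟘 = yes refl
𝟘 ≟Σ 𝟙 = no λ ()
𝟘 ≟Σ 𝟚 = no λ ()
𝟙 ≟Σ 𝟘 = no λ ()
𝟙 ≟Σ 𝟙 = yes refl
𝟙 ≟Σ 𝟚 = no λ ()
𝟚 ≟Σ 𝟘 = no λ ()
𝟚 ≟Σ 𝟙 = no λ ()
𝟚 ≟Σ 𝟚 = yes refl

Word : Set
Word = List Σ₃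

ωWord : Set
ωWord = ℕ → Σ₃

_≟W_ : DecidableEquality Word
_≟W_ = LP.≡-dec _≟Σ_

hl : Σ₃ → Word
hl 𝟘 = 𝟘 ∷ 𝟙 ∷ []
hl 𝟙 = 𝟘 ∷ 𝟚 ∷ []
hl 𝟚 = 𝟘 ∷ 𝟚 ∷ 𝟚 ∷ []

h : Word → Word
h = concatMap hl

factorAt : ωWord → ℕ → ℕ → Word
factorAt u i zero    = []
factorAt u i (suc n) = u i ∷ factorAt u (suc i) n

prefix : ωWord → ℕ → Word
prefix u m = factorAt u 0 m

Factor : Word → ωWord → Set
Factor w u = ∃ λ i → factorAt u i (length w) ≡ w

Palindrome : Word → Set
Palindrome w = reverse w ≡ w

palindrome? : (w : Word) → Dec (Palindrome w)
palindrome? w = reverse w ≟W w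

NonEmpty : Word → Set
NonEmpty w = w ≢ []

nonEmpty? : (w : Word) → Dec (NonEmpty w)
nonEmpty? [] = no λ ne → ne refl
nonEmpty? (x ∷ w) = yes λ ()

factorsOf : Word → List Word
factorsOf w = concatMap (λ i → map (λ j → take j (drop i w)) (upTo (suc (length w ∸ i)))) (upTo (suc (length w)))

palFactors : Word → List Word
palFactors w = deduplicate _≟W_ (filter palindrome? (filter nonEmpty? (factorsOf w)))

RichFinite : Word → Set
RichFinite w = length (palFactors w) ≡ length w

Rich : ωWord → Set
Rich u = ∀ i n → RichFinite (factorAt u i n)

CubeFree : ωWord → Set
CubeFree u = ∀ x → NonEmpty x → ¬ Factor (x ++ x ++ x) u

F : List Word
F = (𝟙 ∷ 𝟚 ∷ 𝟚 ∷ 𝟙 ∷ []) ∷ (𝟘 ∷ 𝟘 ∷ []) ∷ (𝟙 ∷ 𝟘 ∷ 𝟙 ∷ 𝟘 ∷ 𝟙 ∷ []) ∷ (𝟚 ∷ 𝟙 ∷ 𝟚 ∷ []) ∷ (𝟙 ∷ 𝟙 ∷ []) ∷ []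

suffixFrom : ωWord → ℕ → ωWord
suffixFrom u k n = u (k + n)

-- v = h(W) for infinite words: h(W) is the limit of the h(W[0..m));
-- since h is non-erasing, v = h(W) iff every h(W[0..m)) is a prefix of v
IsImage : ωWord → ωWord → Set
IsImage v W = ∀ m → prefix v (length (h (prefix W m))) ≡ h (prefix W m)

-- The forbidden factors together with cube-freeness and richness leave so few factors that an
-- exhaustive search over words of length 13 shows: every factor of length 13 contains a 0, and
-- every 0 begins 010, 020 or 0220, that is h(x) followed by 0.  Hence, starting at some 0, u
-- splits into consecutive blocks h(x₀) h(x₁) …, and W = x₀ x₁ … is the required word.
module Submission where

open import Defs
open import Data.Bool using (Bool; true; false; T; not; _∧_; _∨_)
open import Data.Bool.Properties using (T-∧; T-∨; T-≡)
open import Data.Empty using (⊥-elim)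
open import Data.List using ([]; _∷_; _++_; _∷ʳ_; length; take; head)
import Data.List.Properties as List
open import Data.List.Membership.Propositional using (_∈_)
open import Data.List.Relation.Unary.Any using (here; there; any?)
open import Data.Maybe using (just)
import Data.Maybe.Properties as Maybe
open import Data.Nat using (ℕ; zero; suc; _+_; _≤_; _/_; _≟_; s≤s; z≤n)
open import Data.Nat.Properties using (+-suc; +-identityʳ; +-comm; +-assoc; ≤-trans)
open import Data.Product using (∃; Σ; _×_; _,_; proj₁; proj₂)
open import Data.Sum using (_⊎_; inj₁; inj₂; [_,_]′)
open import Function using (_∘_)
open import Function.Bundles using (Equivalence)
open import Relation.Nullary using (¬_; Dec)
open import Relation.Nullary.Decidable using (⌊_⌋; toWitness; toWitnessFalse; map′; _×-dec_; _⊎-dec_; _→-dec_)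
open import Relation.Binary.PropositionalEquality using (_≡_; refl; sym; trans; cong; cong₂; subst; module ≡-Reasoning)

open Equivalence using (to; from)

factorAt-++ : ∀ (u : ωWord) i m n → factorAt u i (m + n) ≡ factorAt u i m ++ factorAt u (i + m) n
factorAt-++ u i zero    n = cong (λ k → factorAt u k n) (sym (+-identityʳ i))
factorAt-++ u i (suc m) n = cong (u i ∷_) (trans (factorAt-++ u (suc i) m n)
  (cong (λ k → factorAt u (suc i) m ++ factorAt u k n) (sym (+-suc i m))))

factorAt-∷ʳ : ∀ (u : ωWord) i m → factorAt u i (suc m) ≡ factorAt u i m ∷ʳ u (i + m)
factorAt-∷ʳ u i m = trans (cong (factorAt u i) (+-comm 1 m)) (factorAt-++ u i m 1)

take-factorAt : ∀ (u : ωWord) i {m n} → m ≤ n → take m (factorAt u i n) ≡ factorAt u i m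
take-factorAt u i z≤n       = refl
take-factorAt u i (s≤s m≤n) = cong (u i ∷_) (take-factorAt u (suc i) m≤n)

factorAt-suffixFrom : ∀ (u : ωWord) k i n → factorAt (suffixFrom u k) i n ≡ factorAt u (k + i) n
factorAt-suffixFrom u k i zero    = refl
factorAt-suffixFrom u k i (suc n) = cong (u (k + i) ∷_) (trans (factorAt-suffixFrom u k (suc i) n)
  (cong (λ j → factorAt u j n) (+-suc k i)))

prefix-suffixFrom : ∀ (u : ωWord) k n → prefix (suffixFrom u k) n ≡ factorAt u k n
prefix-suffixFrom u k n = trans (factorAt-suffixFrom u k 0 n) (cong (λ i → factorAt u i n) (+-identityʳ k))

∈-factorAt : ∀ (u : ωWord) {a} i n → a ∈ factorAt u i n → ∃ λ k → u k ≡ a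
∈-factorAt u i (suc n) (here a≡ui) = i , sym a≡ui
∈-factorAt u i (suc n) (there a∈) = ∈-factorAt u (suc i) n a∈

∃Σ₃? : {P : Σ₃ → Set} → (∀ x → Dec (P x)) → Dec (∃ P)
∃Σ₃? {P} P? = map′ witness cases (P? 𝟘 ⊎-dec P? 𝟙 ⊎-dec P? 𝟚)
  where
  witness : P 𝟘 ⊎ P 𝟙 ⊎ P 𝟚 → ∃ P
  witness (inj₁ p)        = 𝟘 , p
  witness (inj₂ (inj₁ p)) = 𝟙 , p
  witness (inj₂ (inj₂ p)) = 𝟚 , p
  cases : ∃ P → P 𝟘 ⊎ P 𝟙 ⊎ P 𝟚
  cases (𝟘 , p) = inj₁ p
  cases (𝟙 , p) = inj₂ (inj₁ p)
  cases (𝟚 , p) = inj₂ (inj₂ p)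

module ExhaustiveSearch (bad : Word → Bool) {Good : Word → Set} (good? : ∀ w → Dec (Good w)) where

  hasBadSuffix : Word → Bool
  hasBadSuffix []      = false
  hasBadSuffix (a ∷ w) = bad (a ∷ w) ∨ hasBadSuffix w

  forAllLetters : (Σ₃ → Bool) → Bool
  forAllLetters p = p 𝟘 ∧ p 𝟙 ∧ p 𝟚

  forAllLetters-sound : ∀ p → T (forAllLetters p) → ∀ c → T (p c)
  forAllLetters-sound p t 𝟘 = proj₁ (to (T-∧ {p 𝟘}) t)
  forAllLetters-sound p t 𝟙 = proj₁ (to (T-∧ {p 𝟙}) (proj₂ (to (T-∧ {p 𝟘}) t)))
  forAllLetters-sound p t 𝟚 = proj₂ (to (T-∧ {p 𝟙}) (proj₂ (to (T-∧ {p 𝟘}) t)))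

  -- Pruning at a bad suffix suffices: the other factors of w ∷ʳ c were tested on shorter prefixes.
  allExtensionsGood : ℕ → Word → Bool
  allExtensionsGood zero    w = hasBadSuffix w ∨ ⌊ good? w ⌋
  allExtensionsGood (suc n) w = hasBadSuffix w ∨ forAllLetters (λ c → allExtensionsGood n (w ∷ʳ c))

  module _ {u : ωWord} (bad-absent : ∀ {s} → Factor s u → ¬ T (bad s)) where

    hasBadSuffix-absent : ∀ {w} j → factorAt u j (length w) ≡ w → ¬ T (hasBadSuffix w)
    hasBadSuffix-absent {a ∷ w} j eq t =
      [ bad-absent (j , eq) , hasBadSuffix-absent (suc j) (List.∷-injectiveʳ eq) ]′ (to (T-∨ {bad (a ∷ w)}) t)

    unlessBadSuffix : ∀ {w b} j → factorAt u j (length w) ≡ w → T (hasBadSuffix w ∨ b) → T b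
    unlessBadSuffix {w} j eq t = [ ⊥-elim ∘ hasBadSuffix-absent j eq , (λ b → b) ]′ (to (T-∨ {hasBadSuffix w}) t)

    allExtensionsGood-sound : ∀ n {w} j → factorAt u j (length w) ≡ w →
                              T (allExtensionsGood n w) → Good (factorAt u j (length w + n))
    allExtensionsGood-sound zero {w} j eq t =
      subst Good (sym (trans (cong (factorAt u j) (+-identityʳ (length w))) eq))
        (toWitness (unlessBadSuffix j eq t))
    allExtensionsGood-sound (suc n) {w} j eq t =
      subst (λ m → Good (factorAt u j m)) length-w+1+n
        (allExtensionsGood-sound n j eq′
          (forAllLetters-sound (λ c → allExtensionsGood n (w ∷ʳ c)) (unlessBadSuffix j eq t) c))
      where
      c = u (j + length w)
      length-∷ʳ : length (w ∷ʳ c) ≡ length w + 1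
      length-∷ʳ = List.length-++ w
      length-w+1+n : length (w ∷ʳ c) + n ≡ length w + suc n
      length-w+1+n = trans (cong (_+ n) length-∷ʳ) (+-assoc (length w) 1 n)
      eq′ : factorAt u j (length (w ∷ʳ c)) ≡ w ∷ʳ c
      eq′ = trans (cong (factorAt u j) (trans length-∷ʳ (+-comm (length w) 1)))
                  (trans (factorAt-∷ʳ u j (length w)) (cong (_∷ʳ c) eq))

    windows-good : ∀ n → allExtensionsGood n [] ≡ true → ∀ j → Good (factorAt u j n)
    windows-good n t j = allExtensionsGood-sound n j refl (from T-≡ t)

BlockAt : ωWord → ℕ → Σ₃ → Set
BlockAt u j x = factorAt u j (suc (length (hl x))) ≡ hl x ∷ʳ 𝟘

BlockAt-split : ∀ {u j x} → BlockAt u j x → factorAt u j (length (hl x)) ≡ hl x × u (j + length (hl x)) ≡ 𝟘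
BlockAt-split {u} {j} {x} b = List.∷ʳ-injective _ (hl x) (trans (sym (factorAt-∷ʳ u j (length (hl x)))) b)

module Parse (u : ωWord) (block : ∀ j → u j ≡ 𝟘 → ∃ (BlockAt u j)) (k : ℕ) (u[k]≡0 : u k ≡ 𝟘) where

  ZeroPosition : Set
  ZeroPosition = Σ ℕ λ j → u j ≡ 𝟘

  blockAt : (p : ZeroPosition) → ∃ (BlockAt u (proj₁ p))
  blockAt (j , u[j]≡0) = block j u[j]≡0

  next : ZeroPosition → ZeroPosition
  next p = proj₁ p + length (hl (proj₁ (blockAt p))) , proj₂ (BlockAt-split (proj₂ (blockAt p)))

  position : ℕ → ZeroPosition
  position zero    = k , u[k]≡0
  position (suc n) = next (position n)

  W : ωWord
  W n = proj₁ (blockAt (position n))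

  image-from : ∀ n m → factorAt u (proj₁ (position n)) (length (h (factorAt W n m))) ≡ h (factorAt W n m)
  image-from n zero    = refl
  image-from n (suc m) = begin
    factorAt u j (length (hl x ++ h rest))                      ≡⟨ cong (factorAt u j) (List.length-++ (hl x)) ⟩
    factorAt u j (length (hl x) + length (h rest))              ≡⟨ factorAt-++ u j (length (hl x)) (length (h rest)) ⟩
    factorAt u j (length (hl x)) ++ factorAt u (j + length (hl x)) (length (h rest))
                                                                ≡⟨ cong₂ _++_ (proj₁ (BlockAt-split (proj₂ (blockAt (position n)))))
                                                                               (image-from (suc n) m) ⟩
    hl x ++ h rest                                              ∎
    where
    open ≡-Reasoning
    j = proj₁ (position n)
    x = W n
    rest = factorAt W (suc n) m

  isImage : IsImage (suffixFrom u k) W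
  isImage m = trans (prefix-suffixFrom u k _) (image-from 0 m)

BlockAt⇒suffix-IsImage : ∀ u → (∀ j → u j ≡ 𝟘 → ∃ (BlockAt u j)) → ∀ k → u k ≡ 𝟘 → Σ ωWord (IsImage (suffixFrom u k))
BlockAt⇒suffix-IsImage u block k u[k]≡0 = W , isImage
  where open Parse u block k u[k]≡0

cubeRoot : Word → Word
cubeRoot s = take (length s / 3) s

cube? : ∀ s → Dec (NonEmpty (cubeRoot s) × s ≡ cubeRoot s ++ cubeRoot s ++ cubeRoot s)
cube? s = nonEmpty? (cubeRoot s) ×-dec s ≟W (cubeRoot s ++ cubeRoot s ++ cubeRoot s)

forbidden : Word → Bool
forbidden s = ⌊ any? (s ≟W_) F ⌋ ∨ ⌊ cube? s ⌋ ∨ not ⌊ length (palFactors s) ≟ length s ⌋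

forbidden-absent : ∀ {u} → CubeFree u → Rich u → (∀ f → f ∈ F → ¬ Factor f u) →
                   ∀ {s} → Factor s u → ¬ T (forbidden s)
forbidden-absent {u} cube-free rich avoids-F {s} (i , eq) t with to (T-∨ {⌊ any? (s ≟W_) F ⌋}) t
... | inj₁ s∈F = avoids-F s (toWitness s∈F) (i , eq)
... | inj₂ t′ with to (T-∨ {⌊ cube? s ⌋}) t′
...   | inj₁ cube = let root≢[] , s≡cube = toWitness cube in
                    cube-free (cubeRoot s) root≢[] (subst (λ w → Factor w u) s≡cube (i , eq))
...   | inj₂ poor = toWitnessFalse poor (subst RichFinite eq (rich i (length s)))

BeginsWithBlock : Word → Set
BeginsWithBlock w = ∃ λ x → take (suc (length (hl x))) w ≡ hl x ∷ʳ 𝟘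

beginsWithBlock? : ∀ w → Dec (BeginsWithBlock w)
beginsWithBlock? w = ∃Σ₃? (λ x → take (suc (length (hl x))) w ≟W (hl x ∷ʳ 𝟘))

ParsableWindow : Word → Set
ParsableWindow w = (head w ≡ just 𝟘 → BeginsWithBlock w) × 𝟘 ∈ w

parsableWindow? : ∀ w → Dec (ParsableWindow w)
parsableWindow? w = (Maybe.≡-dec _≟Σ_ (head w) (just 𝟘) →-dec beginsWithBlock? w) ×-dec any? (𝟘 ≟Σ_) w

-- Stated with ≡ rather than T: Agda decides it by evaluation far faster in this form.
allWindowsParsable : ExhaustiveSearch.allExtensionsGood forbidden parsableWindow? 13 [] ≡ true
allWindowsParsable = refl

length-block≤4 : ∀ x → suc (length (hl x)) ≤ 4
length-block≤4 𝟘 = s≤s (s≤s (s≤s z≤n))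
length-block≤4 𝟙 = s≤s (s≤s (s≤s z≤n))
length-block≤4 𝟚 = s≤s (s≤s (s≤s (s≤s z≤n)))

ParsableWindow⇒BlockAt : ∀ u j {n} → 4 ≤ n → ParsableWindow (factorAt u j n) → u j ≡ 𝟘 → ∃ (BlockAt u j)
ParsableWindow⇒BlockAt u j {suc n} 4≤n (opens , _) u[j]≡0 =
  let x , b = opens (cong just u[j]≡0) in
  x , trans (sym (take-factorAt u j (≤-trans (length-block≤4 x) 4≤n))) b

lemma11 : (u : ωWord) → CubeFree u → Rich u → (∀ f → f ∈ F → ¬ Factor f u) → ∃ λ k → Σ ωWord λ W → IsImage (suffixFrom u k) W
lemma11 u cube-free rich avoids-F =
  let k , u[k]≡0 = ∈-factorAt u 0 13 (proj₂ (window 0)) in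
  k , BlockAt⇒suffix-IsImage u (λ j → ParsableWindow⇒BlockAt u j 4≤13 (window j)) k u[k]≡0
  where
  window : ∀ j → ParsableWindow (factorAt u j 13)
  window = ExhaustiveSearch.windows-good forbidden {ParsableWindow} parsableWindow?
             (forbidden-absent cube-free rich avoids-F) 13 allWindowsParsable
  4≤13 : 4 ≤ 13
  4≤13 = s≤s (s≤s (s≤s (s≤s z≤n)))
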